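{- Let $G$ be a finite connected simple graph with $n_V$ vertices and $n_E$ edges, and let $u\in\mathbb{C}$ satisfy $u\neq 1$ and $u\neq -t_v$ for every vertex $v$ (equivalently, $Q_u$ is invertible). Then for every $c\neq 0$, as rational functions of $q$, \[ \zeta_G(1/(cq),u)=\frac{1}{\prod_{v\in V}(1-u)(t_v+u)}\,\frac{(c^2q^2)^{n_E}}{(c^2q^2-(1-u)^2)^{n_E-n_V}}\,\det\!\left(I_{n_V}-cq\,Q_u^{ -1}A+c^2q^2\,Q_u^{ -1}\right)^{ -1}. \]
   Context: $G$ has vertex set $V$, edge set $E$, each edge given an orientation; $E_D$ denotes the $2n_E$ directed edges (each edge with both orientations), and for a directed edge $\mathbf e$ we write $s(\mathbf e),t(\mathbf e)$ for its source and target and $\mathbf e^{ -1}$ for its reverse. $A$ is the $n_V\times n_V$ adjacency matrix, $D=\mathrm{diag}(\deg v)_{v\in V}$, $t_v=\deg v-1$, and $Q_u=(1-u)\bigl(D-(1-u)I_{n_V}\bigr)$. The Bartholdi zeta function is defined for small $|q|,|u|$ by the Euler product $\zeta_G(q,u)=\prod_{[C]}(1-q^{|C|}u^{b(C)})^{ -1}$ over rotation-equivalence classes of primitive cycles $C$ (closed walks on directed edges), where $|C|$ is the length and $b(C)$ the number of bumps (consecutive pairs $\mathbf e_j,\mathbf e_{j+1}=\mathbf e_j^{ -1}$, counted cyclically). It is known to equal the rational function $(1-(1-u)^2q^2)^{ -(n_E-n_V)}\det(I_{n_V}-qA+q^2Q_u)^{ -1}$, and $\zeta_G(q,u)$ denotes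 this rational function (its analytic continuation) for all $q,u$. -}

module Defs where

open import Level using (Level; _⊔_) renaming (suc to lsuc)
open import Algebra.Bundles using (CommutativeRing)
open import Data.Nat as ℕ using (ℕ; zero; suc)
open import Data.Integer as ℤ using (ℤ; +_; -[1+_]; _⊖_)
open import Data.Fin using (Fin; zero; suc; toℕ; punchIn; _≟_)
open import Relation.Nullary using (yes; no)
open import Data.Bool using (Bool; true; false; if_then_else_; _∧_)
open import Relation.Binary.PropositionalEquality using (_≡_)
open import Relation.Nullary using (¬_)

-- We use the common convention of a total
-- inverse function, constrained only on nonzero elements; every
-- expression of the theorem with a ⁻¹ gets an explicit nonvanishing
-- hypothesis, so the value of 0⁻¹ never matters.

record Field (c ℓ : Level) : Set (lsuc (c ⊔ ℓ)) where
  field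
    commutativeRing : CommutativeRing c ℓ
  open CommutativeRing commutativeRing public
  infix 8 _⁻¹
  field
    _⁻¹        : Carrier → Carrier
    ⁻¹-cong    : ∀ {x y} → x ≈ y → x ⁻¹ ≈ y ⁻¹
    ⁻¹-inverse : ∀ x → ¬ x ≈ 0# → x * x ⁻¹ ≈ 1#
    0≉1        : ¬ 0# ≈ 1#

record Graph (n : ℕ) : Set where
  field
    adj    : Fin n → Fin n → Bool
    sym    : ∀ i j → adj i j ≡ adj j i
    irrefl : ∀ i → adj i i ≡ false
open Graph public

Σℕ : ∀ {n} → (Fin n → ℕ) → ℕ
Σℕ {zero}  f = 0
Σℕ {suc n} f = f zero ℕ.+ Σℕ (λ i → f (suc i))

data Reachable {n} (G : Graph n) : Fin n → Fin n → Set where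
  here : ∀ {i} → Reachable G i i
  step : ∀ {i j k} → adj G i j ≡ true → Reachable G j k → Reachable G i k

Connected : ∀ {n} → Graph n → Set
Connected G = ∀ i j → Reachable G i j

degree : ∀ {n} → Graph n → Fin n → ℕ
degree G v = Σℕ (λ w → if adj G v w then 1 else 0)

nE : ∀ {n} → Graph n → ℕ
nE G = Σℕ (λ i → Σℕ (λ j → if (toℕ i ℕ.<ᵇ toℕ j) ∧ adj G i j then 1 else 0))

nV : ∀ {n} → Graph n → ℕ
nV {n} _ = n

module LinAlg {c ℓ} (F : Field c ℓ) where
  open Field F using (Carrier; _≈_; _+_; _*_; -_; 0#; 1#; _⁻¹)

  _−_ : Carrier → Carrier → Carrier
  x − y = x + (- y)

  fromℕ : ℕ → Carrier
  fromℕ zero    = 0#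
  fromℕ (suc n) = 1# + fromℕ n

  _^_ : Carrier → ℕ → Carrier
  x ^ zero  = 1#
  x ^ suc k = x * (x ^ k)

  _^ℤ_ : Carrier → ℤ → Carrier
  x ^ℤ (+ k)     = x ^ k
  x ^ℤ -[1+ k ]  = (x ^ suc k) ⁻¹

  Σ : ∀ {n} → (Fin n → Carrier) → Carrier
  Σ {zero}  f = 0#
  Σ {suc n} f = f zero + Σ (λ i → f (suc i))

  Π : ∀ {n} → (Fin n → Carrier) → Carrier
  Π {zero}  f = 1#
  Π {suc n} f = f zero * Π (λ i → f (suc i))

  Matrix : ℕ → Set c
  Matrix n = Fin n → Fin n → Carrier

  _≈ᴹ_ : ∀ {n} → Matrix n → Matrix n → Set ℓ
  M ≈ᴹ N = ∀ i j → M i j ≈ N i j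

  I : ∀ {n} → Matrix n
  I i j with i ≟ j
  ... | yes _ = 1#
  ... | no _  = 0#

  diag : ∀ {n} → (Fin n → Carrier) → Matrix n
  diag d i j = d i * I i j

  _⊕_ : ∀ {n} → Matrix n → Matrix n → Matrix n
  (M ⊕ N) i j = M i j + N i j

  _⊖ᴹ_ : ∀ {n} → Matrix n → Matrix n → Matrix n
  (M ⊖ᴹ N) i j = M i j − N i j

  _·_ : ∀ {n} → Carrier → Matrix n → Matrix n
  (x · M) i j = x * M i j

  _⋆_ : ∀ {n} → Matrix n → Matrix n → Matrix n
  (M ⋆ N) i j = Σ (λ k → M i k * N k j)

  sign : ℕ → Carrier
  sign zero          = 1#
  sign (suc zero)    = - 1#
  sign (suc (suc k)) = sign k

  det : ∀ {n} → Matrix n → Carrier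
  det {zero}  M = 1#
  det {suc n} M = Σ (λ j → sign (toℕ j) * (M zero j * det (λ r s → M (suc r) (punchIn j s))))

  module _ {n} (G : Graph n) where
    A : Matrix n
    A i j = if adj G i j then 1# else 0#

    D : Matrix n
    D = diag (λ v → fromℕ (degree G v))

    t : Fin n → Carrier
    t v = fromℕ (degree G v) − 1#

    Q : Carrier → Matrix n
    Q u = (1# − u) · (D ⊖ᴹ ((1# − u) · I))

    -- Bartholdi zeta function, as the rational function
    -- (1-(1-u)^2 q^2)^{-(n_E-n_V)} det(I - qA + q^2 Q_u)^{-1}
    ζ : Carrier → Carrier → Carrier
    ζ q u = ((1# − (((1# − u) ^ 2) * (q ^ 2))) ^ℤ (ℤ.- (nE G ⊖ nV G)))
            * (det ((I ⊖ᴹ (q · A)) ⊕ ((q ^ 2) · Q u))) ⁻¹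

{-# OPTIONS --safe #-}
module Submission where

-- Q_u is the diagonal matrix with entries (1-u)(t_v+u).  Hence at x = 1/(cq) the matrix
-- I - xA + x²Q_u is obtained from I - cq Q_u⁻¹A + c²q² Q_u⁻¹ by scaling row v by
-- x²(1-u)(t_v+u), and its determinant picks up the factor x^(2n_V) ∏_v (1-u)(t_v+u).
-- Together with 1 - (1-u)²x² = x²(c²q² - (1-u)²) and x² c²q² = 1 the powers of x²
-- collect into (c²q²)^(n_E).

open import Defs hiding (sym)
open import Level using (Level)
open import Data.Nat using (ℕ; zero; suc)
open import Data.Integer as ℤ using (ℤ; +_; -[1+_]; _⊖_)
open import Data.Integer.Properties using ([1+m]⊖[1+n]≡m⊖n)
open import Data.Fin using (Fin; zero; suc; toℕ; punchIn; _≟_)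
open import Relation.Nullary using (¬_; yes; no)
import Algebra.Solver.Ring.NaturalCoefficients.Default as NaturalCoefficients
import Algebra.Properties.Ring as RingProperties
import Relation.Binary.Reasoning.Setoid as SetoidReasoning

module FieldProperties {a ℓ} (F : Field a ℓ) where
  open Field F hiding (zero)
  open LinAlg F using (_^_; _^ℤ_)
  open SetoidReasoning setoid
  open NaturalCoefficients commutativeSemiring using (solve; _:=_; _:*_)

  ⁻¹-inverseˡ : ∀ {x} → x ≉ 0# → x ⁻¹ * x ≈ 1#
  ⁻¹-inverseˡ {x} x≉0 = trans (*-comm (x ⁻¹) x) (⁻¹-inverse x x≉0)

  x*y≈z⇒y≈x⁻¹*z : ∀ {x y z} → x ≉ 0# → x * y ≈ z → y ≈ x ⁻¹ * z
  x*y≈z⇒y≈x⁻¹*z {x} {y} {z} x≉0 xy≈z = begin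
    y                ≈⟨ *-identityˡ y ⟨
    1# * y           ≈⟨ *-congʳ (⁻¹-inverseˡ x≉0) ⟨
    (x ⁻¹ * x) * y   ≈⟨ *-assoc (x ⁻¹) x y ⟩
    x ⁻¹ * (x * y)   ≈⟨ *-congˡ xy≈z ⟩
    x ⁻¹ * z         ∎

  x*y≈1⇒x≉0 : ∀ {x y} → x * y ≈ 1# → x ≉ 0#
  x*y≈1⇒x≉0 {x} {y} xy≈1 x≈0 = 0≉1 (trans (sym (zeroˡ y)) (trans (*-congʳ (sym x≈0)) xy≈1))

  inverseʳ-unique : ∀ {x y} → x * y ≈ 1# → y ≈ x ⁻¹
  inverseʳ-unique {x} xy≈1 =
    trans (x*y≈z⇒y≈x⁻¹*z (x*y≈1⇒x≉0 xy≈1) xy≈1) (*-identityʳ (x ⁻¹))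

  *-nonzero : ∀ {x y} → x ≉ 0# → y ≉ 0# → x * y ≉ 0#
  *-nonzero {x} x≉0 y≉0 xy≈0 = y≉0 (trans (x*y≈z⇒y≈x⁻¹*z x≉0 xy≈0) (zeroʳ (x ⁻¹)))

  ⁻¹-nonzero : ∀ {x} → x ≉ 0# → x ⁻¹ ≉ 0#
  ⁻¹-nonzero {x} x≉0 x⁻¹≈0 =
    0≉1 (trans (sym (zeroʳ x)) (trans (*-congˡ (sym x⁻¹≈0)) (⁻¹-inverse x x≉0)))

  ⁻¹-involutive : ∀ {x} → x ≉ 0# → x ⁻¹ ⁻¹ ≈ x
  ⁻¹-involutive x≉0 = sym (inverseʳ-unique (⁻¹-inverseˡ x≉0))

  ⁻¹-distrib-* : ∀ {x y} → x ≉ 0# → y ≉ 0# → (x * y) ⁻¹ ≈ x ⁻¹ * y ⁻¹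
  ⁻¹-distrib-* {x} {y} x≉0 y≉0 = sym (inverseʳ-unique (begin
    (x * y) * (x ⁻¹ * y ⁻¹)
      ≈⟨ solve 4 (λ x y x′ y′ → (x :* y) :* (x′ :* y′) := (x :* x′) :* (y :* y′)) refl x y (x ⁻¹) (y ⁻¹) ⟩
    (x * x ⁻¹) * (y * y ⁻¹)      ≈⟨ *-cong (⁻¹-inverse x x≉0) (⁻¹-inverse y y≉0) ⟩
    1# * 1#                      ≈⟨ *-identityˡ 1# ⟩
    1#                           ∎))

  ^-cong : ∀ {x y} n → x ≈ y → x ^ n ≈ y ^ n
  ^-cong zero    x≈y = refl
  ^-cong (suc n) x≈y = *-cong x≈y (^-cong n x≈y)

  ^-nonzero : ∀ {x} n → x ≉ 0# → x ^ n ≉ 0#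
  ^-nonzero zero    x≉0 = λ 1≈0 → 0≉1 (sym 1≈0)
  ^-nonzero (suc n) x≉0 = *-nonzero x≉0 (^-nonzero n x≉0)

  ^-distrib-* : ∀ x y n → (x * y) ^ n ≈ x ^ n * y ^ n
  ^-distrib-* x y zero    = sym (*-identityˡ 1#)
  ^-distrib-* x y (suc n) = begin
    (x * y) * (x * y) ^ n        ≈⟨ *-congˡ (^-distrib-* x y n) ⟩
    (x * y) * (x ^ n * y ^ n)
      ≈⟨ solve 4 (λ x y xⁿ yⁿ → (x :* y) :* (xⁿ :* yⁿ) := (x :* xⁿ) :* (y :* yⁿ)) refl x y (x ^ n) (y ^ n) ⟩
    (x * x ^ n) * (y * y ^ n)    ∎

  ^-inverse : ∀ {x y} → x * y ≈ 1# → ∀ n → x ^ n * y ^ n ≈ 1#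
  ^-inverse xy≈1 zero    = *-identityˡ 1#
  ^-inverse {x} {y} xy≈1 (suc n) = begin
    (x * x ^ n) * (y * y ^ n)    ≈⟨ ^-distrib-* x y (suc n) ⟨
    (x * y) * (x * y) ^ n        ≈⟨ *-cong xy≈1 (trans (^-distrib-* x y n) (^-inverse xy≈1 n)) ⟩
    1# * 1#                      ≈⟨ *-identityˡ 1# ⟩
    1#                           ∎

  ^ℤ-cong : ∀ {x y} k → x ≈ y → x ^ℤ k ≈ y ^ℤ k
  ^ℤ-cong (+ n)    x≈y = ^-cong n x≈y
  ^ℤ-cong -[1+ n ] x≈y = ⁻¹-cong (^-cong (suc n) x≈y)

  ^ℤ-nonzero : ∀ {x} k → x ≉ 0# → x ^ℤ k ≉ 0#
  ^ℤ-nonzero (+ n)    x≉0 = ^-nonzero n x≉0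
  ^ℤ-nonzero -[1+ n ] x≉0 = ⁻¹-nonzero (^-nonzero (suc n) x≉0)

  ^ℤ-neg : ∀ {x} → x ≉ 0# → ∀ k → x ^ℤ (ℤ.- k) ≈ (x ^ℤ k) ⁻¹
  ^ℤ-neg x≉0 (+ zero)  = inverseʳ-unique (*-identityˡ 1#)
  ^ℤ-neg x≉0 (+ suc n) = refl
  ^ℤ-neg x≉0 -[1+ n ]  = sym (⁻¹-involutive (^-nonzero (suc n) x≉0))

  ^ℤ-distrib-* : ∀ {x y} → x ≉ 0# → y ≉ 0# → ∀ k → (x * y) ^ℤ k ≈ x ^ℤ k * y ^ℤ k
  ^ℤ-distrib-* x≉0 y≉0 (+ n)             = ^-distrib-* _ _ n
  ^ℤ-distrib-* {x} {y} x≉0 y≉0 -[1+ n ] = begin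
    ((x * y) ^ suc n) ⁻¹             ≈⟨ ⁻¹-cong (^-distrib-* x y (suc n)) ⟩
    (x ^ suc n * y ^ suc n) ⁻¹
      ≈⟨ ⁻¹-distrib-* (^-nonzero (suc n) x≉0) (^-nonzero (suc n) y≉0) ⟩
    (x ^ suc n) ⁻¹ * (y ^ suc n) ⁻¹  ∎

  ^ℤ-⊖-* : ∀ {x} → x ≉ 0# → ∀ m n → x ^ℤ (m ⊖ n) * x ^ n ≈ x ^ m
  ^ℤ-⊖-* x≉0 m       zero    = *-identityʳ _
  ^ℤ-⊖-* x≉0 zero    (suc n) = ⁻¹-inverseˡ (^-nonzero (suc n) x≉0)
  ^ℤ-⊖-* {x} x≉0 (suc m) (suc n) rewrite [1+m]⊖[1+n]≡m⊖n m n = begin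
    x ^ℤ (m ⊖ n) * (x * x ^ n)
      ≈⟨ solve 3 (λ k x xⁿ → k :* (x :* xⁿ) := x :* (k :* xⁿ)) refl (x ^ℤ (m ⊖ n)) x (x ^ n) ⟩
    x * (x ^ℤ (m ⊖ n) * x ^ n)   ≈⟨ *-congˡ (^ℤ-⊖-* x≉0 m n) ⟩
    x * x ^ m                    ∎

  reciprocal-rescaling : ∀ {s y z P D} → s * y ≈ 1# → z ≉ 0# → P ≉ 0# → D ≉ 0# → ∀ e n →
    (s * z) ^ℤ (ℤ.- (e ⊖ n)) * ((s ^ n * P) * D) ⁻¹
      ≈ (P ⁻¹ * (y ^ e * (z ^ℤ (e ⊖ n)) ⁻¹)) * D ⁻¹
  reciprocal-rescaling {s} {y} {z} {P} {D} sy≈1 z≉0 P≉0 D≉0 e n = begin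
    (s * z) ^ℤ (ℤ.- k) * N ⁻¹          ≈⟨ *-congʳ (^ℤ-neg sz≉0 k) ⟩
    ((s * z) ^ℤ k) ⁻¹ * N ⁻¹           ≈⟨ ⁻¹-distrib-* (^ℤ-nonzero k sz≉0) N≉0 ⟨
    T ⁻¹                               ≈⟨ inverseʳ-unique T·rhs≈1 ⟨
    (P ⁻¹ * (y ^ e * zᵏ ⁻¹)) * D ⁻¹    ∎
    where
    k : ℤ
    k = e ⊖ n
    zᵏ N T : Carrier
    zᵏ = z ^ℤ k
    N = (s ^ n * P) * D
    T = (s * z) ^ℤ k * N
    s≉0 : s ≉ 0#
    s≉0 = x*y≈1⇒x≉0 sy≈1
    sz≉0 : s * z ≉ 0#
    sz≉0 = *-nonzero s≉0 z≉0
    N≉0 : N ≉ 0#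
    N≉0 = *-nonzero (*-nonzero (^-nonzero n s≉0) P≉0) D≉0
    T≈ : T ≈ (zᵏ * s ^ e) * (P * D)
    T≈ = begin
      (s * z) ^ℤ k * ((s ^ n * P) * D)      ≈⟨ *-congʳ (^ℤ-distrib-* s≉0 z≉0 k) ⟩
      (s ^ℤ k * zᵏ) * ((s ^ n * P) * D)
        ≈⟨ solve 5 (λ a b c d f → (a :* b) :* ((c :* d) :* f) := b :* (a :* c) :* (d :* f))
                 refl (s ^ℤ k) zᵏ (s ^ n) P D ⟩
      (zᵏ * (s ^ℤ k * s ^ n)) * (P * D)     ≈⟨ *-congʳ (*-congˡ (^ℤ-⊖-* s≉0 e n)) ⟩
      (zᵏ * s ^ e) * (P * D)                ∎
    T·rhs≈1 : T * ((P ⁻¹ * (y ^ e * zᵏ ⁻¹)) * D ⁻¹) ≈ 1#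
    T·rhs≈1 = begin
      T * ((P ⁻¹ * (y ^ e * zᵏ ⁻¹)) * D ⁻¹)
        ≈⟨ *-congʳ T≈ ⟩
      ((zᵏ * s ^ e) * (P * D)) * ((P ⁻¹ * (y ^ e * zᵏ ⁻¹)) * D ⁻¹)
        ≈⟨ solve 8 (λ a b c d c′ b′ a′ d′ → ((a :* b) :* (c :* d)) :* ((c′ :* (b′ :* a′)) :* d′)
                         := (a :* a′) :* ((b :* b′) :* ((c :* c′) :* (d :* d′))))
                 refl zᵏ (s ^ e) P D (P ⁻¹) (y ^ e) (zᵏ ⁻¹) (D ⁻¹) ⟩
      (zᵏ * zᵏ ⁻¹) * ((s ^ e * y ^ e) * ((P * P ⁻¹) * (D * D ⁻¹)))
        ≈⟨ *-cong (⁻¹-inverse zᵏ (^ℤ-nonzero k z≉0))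
                  (*-cong (^-inverse sy≈1 e) (*-cong (⁻¹-inverse P P≉0) (⁻¹-inverse D D≉0))) ⟩
      1# * (1# * (1# * 1#))
        ≈⟨ trans (*-identityˡ _) (trans (*-identityˡ _) (*-identityˡ 1#)) ⟩
      1# ∎

module MatrixProperties {a ℓ} (F : Field a ℓ) where
  open Field F hiding (zero)
  open LinAlg F
  open RingProperties ring using (-‿distribˡ-*; -‿distribʳ-*; -1*x≈-x)
  open SetoidReasoning setoid
  open NaturalCoefficients commutativeSemiring using (solve; _:=_; _:*_; _:+_; con)

  scaleRows : ∀ {n} → (Fin n → Carrier) → Matrix n → Matrix n
  scaleRows d M i j = d i * M i j

  Σ-cong : ∀ {n} {f g : Fin n → Carrier} → (∀ i → f i ≈ g i) → Σ f ≈ Σ g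
  Σ-cong {zero}  f≈g = refl
  Σ-cong {suc n} f≈g = +-cong (f≈g zero) (Σ-cong (λ i → f≈g (suc i)))

  *-distribˡ-Σ : ∀ {n} x (f : Fin n → Carrier) → x * Σ f ≈ Σ (λ i → x * f i)
  *-distribˡ-Σ {zero}  x f = zeroʳ x
  *-distribˡ-Σ {suc n} x f = trans (distribˡ x _ _) (+-congˡ (*-distribˡ-Σ x (λ i → f (suc i))))

  Π-*ˡ : ∀ {n} x (f : Fin n → Carrier) → Π (λ i → x * f i) ≈ x ^ n * Π f
  Π-*ˡ {zero}  x f = sym (*-identityˡ 1#)
  Π-*ˡ {suc n} x f = begin
    (x * f zero) * Π (λ i → x * f (suc i))  ≈⟨ *-congˡ (Π-*ˡ x (λ i → f (suc i))) ⟩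
    (x * f zero) * (x ^ n * Π f′)
      ≈⟨ solve 4 (λ x y xⁿ p → (x :* y) :* (xⁿ :* p) := (x :* xⁿ) :* (y :* p)) refl x (f zero) (x ^ n) (Π f′) ⟩
    (x * x ^ n) * (f zero * Π f′)           ∎
    where
    f′ : Fin n → Carrier
    f′ i = f (suc i)

  I-suc : ∀ {n} (i j : Fin n) → I (suc i) (suc j) ≈ I i j
  I-suc i j with i ≟ j
  ... | yes _ = refl
  ... | no _  = refl

  Σ-I-* : ∀ {n} (i : Fin n) (f : Fin n → Carrier) → Σ (λ k → I i k * f k) ≈ f i
  Σ-I-* zero f = begin
    1# * f zero + Σ (λ k → 0# * f (suc k))
      ≈⟨ +-cong (*-identityˡ _) (sym (*-distribˡ-Σ 0# (λ k → f (suc k)))) ⟩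
    f zero + 0# * Σ (λ k → f (suc k))       ≈⟨ +-congˡ (zeroˡ _) ⟩
    f zero + 0#                             ≈⟨ +-identityʳ _ ⟩
    f zero                                  ∎
  Σ-I-* (suc i) f = begin
    0# * f zero + Σ (λ k → I (suc i) (suc k) * f (suc k))
      ≈⟨ +-cong (zeroˡ _) (Σ-cong (λ k → *-congʳ (I-suc i k))) ⟩
    0# + Σ (λ k → I i k * f (suc k))                       ≈⟨ +-identityˡ _ ⟩
    Σ (λ k → I i k * f (suc k))                            ≈⟨ Σ-I-* i (λ k → f (suc k)) ⟩
    f (suc i)                                              ∎

  ⋆-identityˡ : ∀ {n} (M : Matrix n) → (I ⋆ M) ≈ᴹ M
  ⋆-identityˡ M i j = Σ-I-* i (λ k → M k j)

  ⋆-congˡ : ∀ {n} {M M′ : Matrix n} (N : Matrix n) → M ≈ᴹ M′ → (M ⋆ N) ≈ᴹ (M′ ⋆ N)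
  ⋆-congˡ N M≈M′ i j = Σ-cong (λ k → *-congʳ (M≈M′ i k))

  scaleRows-⋆ : ∀ {n} d (M N : Matrix n) → scaleRows d (M ⋆ N) ≈ᴹ (scaleRows d M ⋆ N)
  scaleRows-⋆ d M N i j = trans (*-distribˡ-Σ (d i) (λ k → M i k * N k j))
                                (Σ-cong (λ k → sym (*-assoc (d i) (M i k) (N k j))))

  diag-⋆ : ∀ {n} d (M : Matrix n) → (diag d ⋆ M) ≈ᴹ scaleRows d M
  diag-⋆ d M i j = begin
    Σ (λ k → (d i * I i k) * M k j)
      ≈⟨ Σ-cong (λ k → solve 3 (λ d δ m → (d :* δ) :* m := δ :* (d :* m)) refl (d i) (I i k) (M k j)) ⟩
    Σ (λ k → I i k * (d i * M k j))   ≈⟨ Σ-I-* i (λ k → d i * M k j) ⟩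
    d i * M i j                       ∎

  det-cong : ∀ {n} {M N : Matrix n} → M ≈ᴹ N → det M ≈ det N
  det-cong {zero}  M≈N = refl
  det-cong {suc n} M≈N = Σ-cong (λ j →
    *-congˡ {sign (toℕ j)} (*-cong (M≈N zero j) (det-cong (λ r s → M≈N (suc r) (punchIn j s)))))

  det-scaleRows : ∀ {n} (d : Fin n → Carrier) (M : Matrix n) → det (scaleRows d M) ≈ Π d * det M
  det-scaleRows {zero}  d M = sym (*-identityˡ 1#)
  det-scaleRows {suc n} d M = begin
    Σ (λ j → sign (toℕ j) * ((d zero * M zero j) * det (scaleRows d′ (minor j))))
      ≈⟨ Σ-cong (λ j → *-congˡ {sign (toℕ j)} (*-congˡ {d zero * M zero j}
                                                        (det-scaleRows d′ (minor j)))) ⟩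
    Σ (λ j → sign (toℕ j) * ((d zero * M zero j) * (Π d′ * det (minor j))))
      ≈⟨ Σ-cong (λ j → solve 5 (λ σ d₀ m p δ → σ :* ((d₀ :* m) :* (p :* δ)) := (d₀ :* p) :* (σ :* (m :* δ)))
                                refl (sign (toℕ j)) (d zero) (M zero j) (Π d′) (det (minor j))) ⟩
    Σ (λ j → Π d * (sign (toℕ j) * (M zero j * det (minor j))))
      ≈⟨ *-distribˡ-Σ (Π d) (λ j → sign (toℕ j) * (M zero j * det (minor j))) ⟨
    Π d * det M
      ∎
    where
    d′ : Fin n → Carrier
    d′ i = d (suc i)
    minor : Fin (suc n) → Matrix n
    minor j r s = M (suc r) (punchIn j s)

  pencil : ∀ {n} → Carrier → Carrier → Matrix n → Matrix n → Matrix n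
  pencil x s A B = (I ⊖ᴹ (x · A)) ⊕ (s · B)

  pencil-reciprocal : ∀ {n} (A B B⁻¹ : Matrix n) (d : Fin n → Carrier) {x p y} →
    B ≈ᴹ diag d → (B ⋆ B⁻¹) ≈ᴹ I → x * p ≈ 1# → x ^ 2 * y ≈ 1# →
    pencil x (x ^ 2) A B ≈ᴹ scaleRows (λ i → x ^ 2 * d i) (pencil p y (B⁻¹ ⋆ A) B⁻¹)
  -- (x²dᵢ)(p (B⁻¹A)ᵢⱼ) = x (xp) (dᵢ (B⁻¹A)ᵢⱼ) = x Aᵢⱼ  and  (x²dᵢ)(y B⁻¹ᵢⱼ) = (x²y)(dᵢ B⁻¹ᵢⱼ) = Iᵢⱼ
  pencil-reciprocal A B B⁻¹ d {x} {p} {y} B≈diag B⋆B⁻¹≈I xp≈1 x²y≈1 i j = sym (begin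
    (x ^ 2 * d i) * ((δ + - (p * b)) + y * e)
      ≈⟨ *-congˡ (+-congʳ (+-congˡ (-‿distribˡ-* p b))) ⟩
    (x ^ 2 * d i) * ((δ + (- p) * b) + y * e)
      ≈⟨ solve 7 (λ x d δ p′ b y e →
             (x :* (x :* con 1) :* d) :* ((δ :+ p′ :* b) :+ y :* e)
             := (x :* (x :* con 1) :* d) :* δ
                :+ ((x :* p′) :* (x :* (d :* b)) :+ ((x :* (x :* con 1)) :* y) :* (d :* e)))
           refl x (d i) δ (- p) b y e ⟩
    (x ^ 2 * d i) * δ + ((x * - p) * (x * (d i * b)) + (x ^ 2 * y) * (d i * e))
      ≈⟨ +-congˡ (+-cong (*-cong (trans (sym (-‿distribʳ-* x p)) (-‿cong xp≈1)) (*-congˡ d·B⁻¹A≈A))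
                         (*-cong x²y≈1 d·B⁻¹≈I)) ⟩
    (x ^ 2 * d i) * δ + ((- 1#) * (x * A i j) + 1# * δ)
      ≈⟨ +-congˡ (+-cong (-1*x≈-x _) (*-identityˡ δ)) ⟩
    (x ^ 2 * d i) * δ + (- (x * A i j) + δ)
      ≈⟨ solve 4 (λ s d δ a → s :* d :* δ :+ (a :+ δ) := (δ :+ a) :+ s :* (d :* δ))
               refl (x ^ 2) (d i) δ (- (x * A i j)) ⟩
    (δ + - (x * A i j)) + x ^ 2 * (d i * δ)
      ≈⟨ +-congˡ (*-congˡ (B≈diag i j)) ⟨
    (δ + - (x * A i j)) + x ^ 2 * B i j
      ∎)
    where
    δ b e : Carrier
    δ = I i j
    b = (B⁻¹ ⋆ A) i j
    e = B⁻¹ i j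
    scaleRows-B⁻¹≈I : scaleRows d B⁻¹ ≈ᴹ I
    scaleRows-B⁻¹≈I r s =
      trans (sym (diag-⋆ d B⁻¹ r s)) (trans (sym (⋆-congˡ B⁻¹ B≈diag r s)) (B⋆B⁻¹≈I r s))
    d·B⁻¹≈I : d i * e ≈ δ
    d·B⁻¹≈I = scaleRows-B⁻¹≈I i j
    d·B⁻¹A≈A : d i * b ≈ A i j
    d·B⁻¹A≈A =
      trans (scaleRows-⋆ d B⁻¹ A i j) (trans (⋆-congˡ A scaleRows-B⁻¹≈I i j) (⋆-identityˡ A i j))

  det-pencil-reciprocal : ∀ {n} (A B B⁻¹ : Matrix n) (d : Fin n → Carrier) {x p y} →
    B ≈ᴹ diag d → (B ⋆ B⁻¹) ≈ᴹ I → x * p ≈ 1# → x ^ 2 * y ≈ 1# →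
    det (pencil x (x ^ 2) A B) ≈ ((x ^ 2) ^ n * Π d) * det (pencil p y (B⁻¹ ⋆ A) B⁻¹)
  det-pencil-reciprocal {n} A B B⁻¹ d {x} {p} {y} B≈diag B⋆B⁻¹≈I xp≈1 x²y≈1 = begin
    det (pencil x (x ^ 2) A B)
      ≈⟨ det-cong (pencil-reciprocal A B B⁻¹ d B≈diag B⋆B⁻¹≈I xp≈1 x²y≈1) ⟩
    det (scaleRows (λ i → x ^ 2 * d i) M)               ≈⟨ det-scaleRows (λ i → x ^ 2 * d i) M ⟩
    Π (λ i → x ^ 2 * d i) * det M                       ≈⟨ *-congʳ (Π-*ˡ (x ^ 2) d) ⟩
    ((x ^ 2) ^ n * Π d) * det M                         ∎
    where
    M : Matrix n
    M = pencil p y (B⁻¹ ⋆ A) B⁻¹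

module GraphMatrices {a ℓ} (F : Field a ℓ) where
  open Field F hiding (zero)
  open LinAlg F
  open RingProperties ring using (-‿distribˡ-*; -‿+-comm; -‿involutive)
  open SetoidReasoning setoid
  open NaturalCoefficients commutativeSemiring using (solve; _:=_; _:*_; _:+_)

  Q-diagonal : ∀ {n} (G : Graph n) u → Q G u ≈ᴹ diag (λ v → (1# − u) * (t G v + u))
  Q-diagonal G u i j = begin
    o * (deg * δ + - (o * δ))          ≈⟨ *-congˡ (+-congˡ (-‿distribˡ-* o δ)) ⟩
    o * (deg * δ + (- o) * δ)          ≈⟨ *-congˡ (+-congˡ (*-congʳ -o≈-1+u)) ⟩
    o * (deg * δ + (- 1# + u) * δ)
      ≈⟨ solve 5 (λ o deg δ m u → o :* (deg :* δ :+ (m :+ u) :* δ) := (o :* ((deg :+ m) :+ u)) :* δ)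
               refl o deg δ (- 1#) u ⟩
    (o * ((deg + - 1#) + u)) * δ       ∎
    where
    o deg δ : Carrier
    o = 1# − u
    deg = fromℕ (degree G i)
    δ = I i j
    -o≈-1+u : - o ≈ - 1# + u
    -o≈-1+u = trans (sym (-‿+-comm 1# (- u))) (+-congˡ (-‿involutive u))

lemma3p1 : ∀ {a ℓ : Level} (F : Field a ℓ) → let open Field F in let open LinAlg F in
    ∀ {n} (G : Graph n) → Connected G →
    (u : Carrier) → ¬ u ≈ 1# → (∀ v → ¬ u ≈ - t G v) →
    (Qi : Matrix n) → (Qi ⋆ Q G u) ≈ᴹ I → (Q G u ⋆ Qi) ≈ᴹ I →
    (c q : Carrier) → ¬ c ≈ 0# → ¬ q ≈ 0# →
    -- pointwise, away from the poles of both sides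
    ¬ det ((I ⊖ᴹ (((c * q) ⁻¹) · A G)) ⊕ ((((c * q) ⁻¹) ^ 2) · Q G u)) ≈ 0# →
    ¬ (1# − (((1# − u) ^ 2) * (((c * q) ⁻¹) ^ 2))) ≈ 0# →
    ¬ (((c ^ 2) * (q ^ 2)) − ((1# − u) ^ 2)) ≈ 0# →
    ¬ det ((I ⊖ᴹ ((c * q) · (Qi ⋆ A G))) ⊕ (((c ^ 2) * (q ^ 2)) · Qi)) ≈ 0# →
    ζ G ((c * q) ⁻¹) u ≈
      ((Π (λ v → (1# − u) * (t G v + u))) ⁻¹)
      * ((((c ^ 2) * (q ^ 2)) ^ nE G)
         * ((((c ^ 2) * (q ^ 2)) − ((1# − u) ^ 2)) ^ℤ (nE G ⊖ nV G)) ⁻¹)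
      * (det ((I ⊖ᴹ ((c * q) · (Qi ⋆ A G))) ⊕ (((c ^ 2) * (q ^ 2)) · Qi))) ⁻¹
-- Connectivity and the conditions on u only make Q_u invertible, which Qi witnesses directly;
-- the pole 1 - (1-u)²x² ≠ 0 is excluded by the other hypotheses.
lemma3p1 F {n} G _ u _ _ Qi _ Q⋆Qi≈I c q c≉0 q≉0 detN≉0 _ z≉0 detM≉0 = begin
  ζ G x u
    ≈⟨ *-cong (^ℤ-cong (ℤ.- (e ⊖ n)) 1-wx²≈x²z) (⁻¹-cong det-N) ⟩
  (x ^ 2 * z) ^ℤ (ℤ.- (e ⊖ n)) * (((x ^ 2) ^ n * P) * det M) ⁻¹
    ≈⟨ reciprocal-rescaling x²y≈1 z≉0 P≉0 detM≉0 e n ⟩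
  (P ⁻¹ * (y ^ e * (z ^ℤ (e ⊖ n)) ⁻¹)) * det M ⁻¹
    ∎
  where
  open Field F hiding (zero)
  open LinAlg F
  open FieldProperties F
  open MatrixProperties F
  open GraphMatrices F
  open RingProperties ring using (-‿distribʳ-*)
  open SetoidReasoning setoid
  open NaturalCoefficients commutativeSemiring using (solve; _:=_; _:*_; con)

  x y z P : Carrier
  x = (c * q) ⁻¹
  y = c ^ 2 * q ^ 2
  z = y − ((1# − u) ^ 2)
  e : ℕ
  e = nE G
  P = Π (λ v → (1# − u) * (t G v + u))
  N M : Matrix n
  N = pencil x (x ^ 2) (A G) (Q G u)
  M = pencil (c * q) y (Qi ⋆ A G) Qi

  x·cq≈1 : x * (c * q) ≈ 1#
  x·cq≈1 = ⁻¹-inverseˡ (*-nonzero c≉0 q≉0)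

  x²y≈1 : x ^ 2 * y ≈ 1#
  x²y≈1 = begin
    x ^ 2 * y
      ≈⟨ solve 3 (λ x c q → (x :* (x :* con 1)) :* ((c :* (c :* con 1)) :* (q :* (q :* con 1)))
                            := (x :* (c :* q)) :* (x :* (c :* q))) refl x c q ⟩
    (x * (c * q)) * (x * (c * q))  ≈⟨ *-cong x·cq≈1 x·cq≈1 ⟩
    1# * 1#                        ≈⟨ *-identityˡ 1# ⟩
    1#                             ∎

  1-wx²≈x²z : 1# − ((1# − u) ^ 2 * x ^ 2) ≈ x ^ 2 * z
  1-wx²≈x²z = sym (begin
    x ^ 2 * (y + - w)              ≈⟨ distribˡ (x ^ 2) y (- w) ⟩
    x ^ 2 * y + x ^ 2 * - w        ≈⟨ +-cong x²y≈1 (sym (-‿distribʳ-* (x ^ 2) w)) ⟩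
    1# + - (x ^ 2 * w)             ≈⟨ +-congˡ (-‿cong (*-comm (x ^ 2) w)) ⟩
    1# + - (w * x ^ 2)             ∎)
    where
    w : Carrier
    w = (1# − u) ^ 2

  det-N : det N ≈ ((x ^ 2) ^ n * P) * det M
  det-N = det-pencil-reciprocal (A G) (Q G u) Qi _ (Q-diagonal G u) Q⋆Qi≈I x·cq≈1 x²y≈1

  P≉0 : P ≉ 0#
  P≉0 P≈0 = detN≉0 (trans det-N (trans (*-congʳ (trans (*-congˡ P≈0) (zeroʳ _))) (zeroˡ _)))
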